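{- Let $q$ be a prime power and $2\le\ell\le m$ integers, and let $\hat d_r$ denote the $r$-th generalized Hamming weight of $\hat C_{\det}(1;\ell,m)$, with $\hat d_m=q^{\ell-1}\frac{q^m-1}{q-1}$. Then for $s=1,\dots,\ell-1$, $$q^{\ell-s-1}\frac{q^{m+s}-1}{q-1}=\hat d_m+q^{\ell-s-1}\frac{q^s-1}{q-1}\le\hat d_{m+s}\le\hat d_m+q^{\ell+m-s-2}\frac{q^s-1}{q-1}.$$ In particular, $\hat d_m+q^{\ell-2}\le\hat d_{m+1}\le\hat d_m+q^{\ell+m-3}$.
   Context: $\mathbb{F}_q$ is the finite field with $q$ elements; $X=(X_{ij})$ is an $\ell\times m$ matrix of indeterminates; $\mathbb{F}_q[X]_1$ is the space of linear homogeneous polynomials $f=\sum f_{ij}X_{ij}$ (with $0$), evaluated at a matrix $M$ by $f(M)=\sum f_{ij}M_{ij}$. Let $\hat M_1,\dots,\hat M_{\hat n}$ be representatives, one from each class of nonzero scalar multiples, of the matrices in $M_{\ell\times m}(\mathbb{F}_q)$ of rank exactly $1$; $\hat C_{\det}(1;\ell,m)=\{(f(\hat M_1),\dots,f(\hat M_{\hat n})):f\in\mathbb{F}_q[X]_1\}$. For a code $C$, the support weight of a subcode $D$ is $\|D\|=|\{i:\exists c\in D,\ c_i\neq0\}|$ and $d_r(C)=\min\{\|D\|:D\subseteq C,\ \dim D=r\}$. -}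

module Defs where

open import Level using (0ℓ)
open import Data.Nat as ℕ using (ℕ; zero; suc; _^_)
open import Data.Fin using (Fin; zero; suc)
open import Data.Fin.Subset using (Subset; _∈_; ∣_∣)
open import Data.List using (List; length)
import Data.List.Membership.Propositional as LM
open import Data.List.Relation.Unary.Unique.Propositional using (Unique)
open import Data.Product using (Σ; ∃; ∃-syntax; _×_; _,_)
open import Relation.Nullary using (¬_; Dec)
open import Relation.Binary.PropositionalEquality using (_≡_; _≢_)
open import Algebra.Structures using (IsCommutativeRing)
open import Function.Bundles using (_⇔_)

record FiniteField : Set₁ where
  infixl 6 _+_
  infixl 7 _*_
  field
    Carrier  : Set
    _+_ _*_  : Carrier → Carrier → Carrier
    -_       : Carrier → Carrier
    0# 1#    : Carrier
    isCommutativeRing : IsCommutativeRing _≡_ _+_ _*_ -_ 0# 1#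
    0≢1      : 0# ≢ 1#
    inverse  : ∀ x → x ≢ 0# → ∃[ y ] (x * y ≡ 1#)
    _≟_      : (x y : Carrier) → Dec (x ≡ y)
    elements : List Carrier
    complete : ∀ x → x LM.∈ elements
    unique   : Unique elements

  card : ℕ
  card = length elements

module _ (F : FiniteField) where
  open FiniteField F

  sumF : (n : ℕ) → (Fin n → Carrier) → Carrier
  sumF zero    f = 0#
  sumF (suc n) f = f zero + sumF n (λ i → f (suc i))

  Mat : ℕ → ℕ → Set
  Mat ℓ m = Fin ℓ → Fin m → Carrier

  RankAtMost : ∀ {ℓ m} → ℕ → Mat ℓ m → Set
  RankAtMost {ℓ} {m} r M =
    Σ (Mat ℓ r) λ U → Σ (Mat r m) λ V →
      ∀ i j → M i j ≡ sumF r (λ k → U i k * V k j)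

  HasRank : ∀ {ℓ m} → ℕ → Mat ℓ m → Set
  HasRank zero    M = RankAtMost 0 M
  HasRank (suc r) M = RankAtMost (suc r) M × ¬ RankAtMost r M

  _·_ : ∀ {ℓ m} → Carrier → Mat ℓ m → Mat ℓ m
  (c · M) i j = c * M i j

  -- linear homogeneous polynomial f = Σ f_ij X_ij (given by its coefficient matrix)
  -- evaluated at a matrix M: f(M) = Σ f_ij M_ij
  eval : ∀ {ℓ m} → Mat ℓ m → Mat ℓ m → Carrier
  eval {ℓ} {m} f M = sumF ℓ (λ i → sumF m (λ j → f i j * M i j))

  -- reps : Fin n → Mat ℓ m is a system of representatives, one from each class
  -- of nonzero scalar multiples, of the rank-1 ℓ×m matrices
  IsRank1Reps : ∀ {ℓ m n} → (Fin n → Mat ℓ m) → Set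
  IsRank1Reps {ℓ} {m} {n} reps =
    (∀ i → HasRank 1 (reps i))
    × (∀ (M : Mat ℓ m) → HasRank 1 M →
         ∃[ i ] ∃[ c ] (c ≢ 0# × ∀ a b → M a b ≡ (c · reps i) a b))
    × (∀ i j c → (∀ a b → reps i a b ≡ (c · reps j) a b) → i ≡ j)

  Word : ℕ → Set
  Word n = Fin n → Carrier

  InCdet : ∀ {ℓ m n} → (Fin n → Mat ℓ m) → Word n → Set
  InCdet {ℓ} {m} reps c = ∃[ f ] (∀ i → c i ≡ eval {ℓ} {m} f (reps i))

  lincomb : ∀ {r n} → (Fin r → Carrier) → (Fin r → Word n) → Word n
  lincomb {r} a b i = sumF r (λ k → a k * b k i)

  LinIndep : ∀ {r n} → (Fin r → Word n) → Set
  LinIndep {r} b = ∀ (a : Fin r → Carrier) → (∀ i → lincomb a b i ≡ 0#) → ∀ k → a k ≡ 0#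

  InSpan : ∀ {r n} → (Fin r → Word n) → Word n → Set
  InSpan {r} b c = ∃[ a ] (∀ i → c i ≡ lincomb {r} a b i)

  -- an r-dimensional subcode D ⊆ C, presented by a basis b of D
  -- (r linearly independent codewords of C; D = span b)
  IsSubcodeBasis : ∀ {ℓ m n} → (Fin n → Mat ℓ m) → (r : ℕ) → (Fin r → Word n) → Set
  IsSubcodeBasis {ℓ} {m} reps r b = (∀ k → InCdet {ℓ} {m} reps (b k)) × LinIndep b

  SupportWeight : ∀ {r n} → (Fin r → Word n) → ℕ → Set
  SupportWeight {r} {n} b w =
    Σ (Subset n) λ S → (∣ S ∣ ≡ w)
      × (∀ i → (i ∈ S) ⇔ (∃[ c ] (InSpan b c × c i ≢ 0#)))

  IsGHW : ∀ {ℓ m n} → (Fin n → Mat ℓ m) → ℕ → ℕ → Set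
  IsGHW {ℓ} {m} {n} reps r d =
    (∃[ b ] (IsSubcodeBasis {ℓ} {m} reps r b × SupportWeight b d))
    × (∀ b w → IsSubcodeBasis {ℓ} {m} reps r b → SupportWeight b w → d ℕ.≤ w)

-- Gaussian integer [k]_q = 1 + q + ... + q^(k-1) = (q^k - 1)/(q - 1)
qint : ℕ → ℕ → ℕ
qint q zero    = 0
qint q (suc k) = q ^ k ℕ.+ qint q k

module Submission where

-- Write ℓ = 1 + s + t and m = 1 + m′, so d_m = q^(s+t)·[m]_q.
--
-- If all r-dimensional subcodes have weight at least
-- q^(e+1)·[r]_q, then an (r+1)-dimensional subcode D has weight at least
-- q^e·[r+1]_q: each nonzero λ ∈ F^(r+1) cuts out an r-dimensional kernel subcode
-- of D, and counting pairs (λ, coordinate) gives (q^(r+1)−1)·q^(e+1)·[r]_q ≤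
-- (q^(r+1)−q)·‖D‖.  Applying this s times to d_m gives d_(m+s) ≥ q^t·[m+s]_q.
--
-- The coordinate forms X_(0,j), X_(a+1,0)
-- (j < m, a < s) span an (m+s)-dimensional subcode; its support consists of the
-- representatives u·vᵀ with u_0·v_j ≠ 0 or u_(a+1)·v_0 ≠ 0, and normalizing (u, v)
-- embeds it into a list of q^(s+t)·[m]_q + [s]_q·q^t·q^m′ vector pairs.

open import Level using (0ℓ)
open import Data.Nat as ℕ using (ℕ; zero; suc; _∸_; _^_; _≤_; z≤n; s≤s; NonZero)
import Data.Nat.Properties as ℕP
import Algebra.Properties.Semiring.Sum ℕP.+-*-semiring as ℕΣ
open import Data.Fin as Fin using (Fin; zero; suc; punchIn; punchOut; splitAt; join; _↑ˡ_)
import Data.Fin.Properties as FinP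
open import Data.Fin.Subset using (Subset; ∣_∣; inside; outside) renaming (_∈_ to _∈ₛ_)
open import Data.Fin.Subset.Properties using (drop-there)
open import Data.Vec as Vec using (Vec; []; _∷_; lookup; tabulate; here; there)
import Data.Vec.Properties as VecP
open import Data.List as List
  using (List; []; _∷_; length; map; filter; _++_; allFin; cartesianProductWith; cartesianProduct)
import Data.List.Properties as ListP
open import Data.List.Membership.Propositional using (_∈_)
open import Data.List.Membership.Propositional.Properties
  using (∈-map⁺; ∈-map⁻; ∈-++⁺ˡ; ∈-++⁺ʳ; ∈-filter⁺; ∈-filter⁻; ∈-cartesianProductWith⁺; ∈-cartesianProduct⁺)
open import Data.List.Relation.Binary.Subset.Propositional using (_⊆_)
open import Data.List.Relation.Unary.Any as Any using (here; there)
open import Data.List.Relation.Unary.All as All using (All; []; _∷_)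
open import Data.List.Relation.Unary.AllPairs using ([]; _∷_)
open import Data.List.Relation.Unary.Unique.Propositional using (Unique)
import Data.List.Relation.Unary.Unique.Propositional.Properties as UniqueP
open import Data.Bool using (if_then_else_)
open import Data.Product using (∃; ∃₂; ∃-syntax; _×_; _,_; proj₁; proj₂)
open import Data.Sum using (_⊎_; inj₁; inj₂)
open import Data.Empty using (⊥-elim)
open import Relation.Nullary using (¬_; Dec; yes; no; does; ¬?)
open import Relation.Nullary.Decidable using (_×-dec_)
open import Relation.Unary using (Pred; Decidable)
open import Relation.Binary.PropositionalEquality
open import Function using (_∘_)
open import Function.Bundles using (_⇔_; mk⇔; Equivalence)
open import Algebra.Bundles using (CommutativeRing)
open import Defs

module Counting where
  open import Data.Nat using (_+_; _*_)

  𝟙[_] : ∀ {p} {P : Set p} → Dec P → ℕ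
  𝟙[ d ] = if does d then 1 else 0

  𝟙-× : ∀ {p q} {P : Set p} {Q : Set q} (P? : Dec P) (Q? : Dec Q) → 𝟙[ P? ×-dec Q? ] ≡ 𝟙[ P? ] * 𝟙[ Q? ]
  𝟙-× (yes _) (yes _) = refl
  𝟙-× (yes _) (no  _) = refl
  𝟙-× (no  _) _       = refl

  𝟙-⇔ : ∀ {p q} {P : Set p} {Q : Set q} → P ⇔ Q → (P? : Dec P) (Q? : Dec Q) → 𝟙[ P? ] ≡ 𝟙[ Q? ]
  𝟙-⇔ P⇔Q (yes _) (yes _) = refl
  𝟙-⇔ P⇔Q (no  _) (no  _) = refl
  𝟙-⇔ P⇔Q (yes p) (no ¬q) = ⊥-elim (¬q (Equivalence.to P⇔Q p))
  𝟙-⇔ P⇔Q (no ¬p) (yes q) = ⊥-elim (¬p (Equivalence.from P⇔Q q))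

  module _ {A : Set} where

    private
      remove : ∀ {x : A} {ys : List A} → x ∈ ys → List A
      remove {ys = y ∷ ys} (here _)  = ys
      remove {ys = y ∷ ys} (there p) = y ∷ remove p

      length-remove : ∀ {x : A} {ys : List A} (p : x ∈ ys) → length ys ≡ suc (length (remove p))
      length-remove (here _)  = refl
      length-remove (there p) = cong suc (length-remove p)

      ∈-remove : ∀ {x y : A} {ys : List A} (p : x ∈ ys) → y ∈ ys → y ≢ x → y ∈ remove p
      ∈-remove (here refl) (here refl) y≢x = ⊥-elim (y≢x refl)
      ∈-remove (here refl) (there q)   _   = q
      ∈-remove (there p)   (here refl) _   = here refl
      ∈-remove (there p)   (there q)   y≢x = there (∈-remove p q y≢x)

    unique-⊆⇒length≤ : ∀ {xs ys : List A} → Unique xs → xs ⊆ ys → length xs ≤ length ys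
    unique-⊆⇒length≤ {[]}     _            _   = z≤n
    unique-⊆⇒length≤ {x ∷ xs} (x∉xs ∷ uxs) sub =
      subst (suc (length xs) ≤_) (sym (length-remove x∈ys))
        (s≤s (unique-⊆⇒length≤ uxs λ y∈xs →
          ∈-remove x∈ys (sub (there y∈xs)) (λ y≡x → All.lookup x∉xs y∈xs (sym y≡x))))
      where x∈ys = sub (here refl)

    unique-⊆⊇⇒length≡ : ∀ {xs ys : List A} → Unique xs → Unique ys → xs ⊆ ys → ys ⊆ xs →
      length xs ≡ length ys
    unique-⊆⊇⇒length≡ uxs uys xs⊆ys ys⊆xs =
      ℕP.≤-antisym (unique-⊆⇒length≤ uxs xs⊆ys) (unique-⊆⇒length≤ uys ys⊆xs)

    map-unique : ∀ {B : Set} (f : A → B) {xs : List A} → Unique xs →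
      (∀ {x y} → x ∈ xs → y ∈ xs → f x ≡ f y → x ≡ y) → Unique (map f xs)
    map-unique f {[]}     []           inj = []
    map-unique f {x ∷ xs} (x∉xs ∷ uxs) inj =
      images-differ xs x∉xs there ∷ map-unique f uxs (λ p q → inj (there p) (there q))
      where
        images-differ : ∀ ys → All (x ≢_) ys → ys ⊆ x ∷ xs → All (f x ≢_) (map f ys)
        images-differ []       []           _   = []
        images-differ (y ∷ ys) (x≢y ∷ x∉ys) sub =
          (λ fx≡fy → x≢y (inj (here refl) (sub (here refl)) fx≡fy))
          ∷ images-differ ys x∉ys (λ p → sub (there p))

    length-filter-∁ : ∀ {p} {P : Pred A p} (P? : Decidable P) xs →
      length (filter P? xs) + length (filter (λ x → ¬? (P? x)) xs) ≡ length xs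
    length-filter-∁ P? []       = refl
    length-filter-∁ P? (x ∷ xs) with P? x
    ... | yes _ = cong suc (length-filter-∁ P? xs)
    ... | no  _ = trans (ℕP.+-suc _ _) (cong suc (length-filter-∁ P? xs))

    sumOver : List A → (A → ℕ) → ℕ
    sumOver []       f = 0
    sumOver (x ∷ xs) f = f x + sumOver xs f

    sumOver-mono : ∀ xs {f g : A → ℕ} → (∀ x → f x ≤ g x) → sumOver xs f ≤ sumOver xs g
    sumOver-mono []       f≤g = z≤n
    sumOver-mono (x ∷ xs) f≤g = ℕP.+-mono-≤ (f≤g x) (sumOver-mono xs f≤g)

    sumOver-cong : ∀ xs {f g : A → ℕ} → (∀ x → f x ≡ g x) → sumOver xs f ≡ sumOver xs g
    sumOver-cong []       f≗g = refl
    sumOver-cong (x ∷ xs) f≗g = cong₂ _+_ (f≗g x) (sumOver-cong xs f≗g)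

    sumOver-*ˡ : ∀ xs c (f : A → ℕ) → sumOver xs (λ x → c * f x) ≡ c * sumOver xs f
    sumOver-*ˡ []       c f = sym (ℕP.*-zeroʳ c)
    sumOver-*ˡ (x ∷ xs) c f =
      trans (cong (c * f x +_) (sumOver-*ˡ xs c f)) (sym (ℕP.*-distribˡ-+ c (f x) _))

    sumOver-𝟙 : ∀ {p} {P : Pred A p} (P? : Decidable P) xs →
      sumOver xs (λ x → 𝟙[ P? x ]) ≡ length (filter P? xs)
    sumOver-𝟙 P? []       = refl
    sumOver-𝟙 P? (x ∷ xs) with P? x
    ... | yes _ = cong suc (sumOver-𝟙 P? xs)
    ... | no  _ = sumOver-𝟙 P? xs

    sumOver-sum : ∀ {n} xs (f : A → Fin n → ℕ) →
      sumOver xs (λ x → ℕΣ.sum (f x)) ≡ ℕΣ.sum (λ i → sumOver xs (λ x → f x i))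
    sumOver-sum {n} []       f = sym (ℕΣ.sum-replicate-zero n)
    sumOver-sum     (x ∷ xs) f =
      trans (cong (ℕΣ.sum (f x) +_) (sumOver-sum xs f)) (sym (ℕΣ.∑-distrib-+ (f x) _))

    sumOver-tabulate : ∀ {n} (g : Fin n → A) (f : A → ℕ) →
      sumOver (List.tabulate g) f ≡ ℕΣ.sum (λ i → f (g i))
    sumOver-tabulate {zero}  g f = refl
    sumOver-tabulate {suc n} g f = cong (f (g Fin.zero) +_) (sumOver-tabulate (λ i → g (Fin.suc i)) f)

  length-cartesianProductWith : ∀ {A B C : Set} (f : A → B → C) xs ys →
    length (cartesianProductWith f xs ys) ≡ length xs * length ys
  length-cartesianProductWith f []       ys = refl
  length-cartesianProductWith f (x ∷ xs) ys =
    trans (ListP.length-++ (map (f x) ys))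
          (cong₂ _+_ (ListP.length-map (f x) ys) (length-cartesianProductWith f xs ys))

open Counting

module Arithmetic where
  open import Data.Nat using (_+_; _*_)
  open import Data.Nat.Solver using (module +-*-Solver)

  qint-geometric : ∀ p k → p * qint (suc p) k + 1 ≡ suc p ^ k
  qint-geometric p zero    = cong (_+ 1) (ℕP.*-zeroʳ p)
  qint-geometric p (suc k) = begin
    p * (q ^ k + qint q k) + 1      ≡⟨ solve 3 (λ p x y → p :* (x :+ y) :+ con 1 := (p :* y :+ con 1) :+ p :* x) refl p (q ^ k) (qint q k) ⟩
    (p * qint q k + 1) + p * q ^ k  ≡⟨ cong (_+ p * q ^ k) (qint-geometric p k) ⟩
    q ^ k + p * q ^ k               ∎
    where open ≡-Reasoning
          open +-*-Solver
          q = suc p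

  pred-^ : ∀ p k → suc p ^ k ∸ 1 ≡ p * qint (suc p) k
  pred-^ p k = trans (cong (_∸ 1) (sym (qint-geometric p k))) (ℕP.m+n∸n≡m _ 1)

  qint-+ : ∀ q a b → qint q (a + b) ≡ qint q b + q ^ b * qint q a
  qint-+ q zero    b = sym (trans (cong (qint q b +_) (ℕP.*-zeroʳ (q ^ b))) (ℕP.+-identityʳ _))
  qint-+ q (suc a) b = begin
    q ^ (a + b) + qint q (a + b)                ≡⟨ cong₂ _+_ (ℕP.^-distribˡ-+-* q a b) (qint-+ q a b) ⟩
    q ^ a * q ^ b + (qint q b + q ^ b * qint q a) ≡⟨ solve 4 (λ x y z w → x :* y :+ (z :+ y :* w) := z :+ y :* (x :+ w)) refl (q ^ a) (q ^ b) (qint q b) (qint q a) ⟩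
    qint q b + q ^ b * (q ^ a + qint q a)       ∎
    where open ≡-Reasoning
          open +-*-Solver

  -- The arithmetic core of the averaging argument: if a weight w satisfies
  -- (q^(r+1) - q)·w ≥ (q^(r+1) - 1)·q^(e+1)·[r]_q, then w ≥ q^e·[r+1]_q,
  -- since (q^(r+1) - 1)·q·[r]_q = (q^(r+1) - q)·[r+1]_q.
  averaging-bound : ∀ q r e w → 2 ≤ q → 1 ≤ r →
    (q ^ suc e * qint q r) * (q ^ suc r ∸ 1) ≤ w * (q ^ suc r ∸ q) →
    q ^ e * qint q (suc r) ≤ w
  averaging-bound (suc (suc p′)) (suc r′) e w (s≤s (s≤s z≤n)) (s≤s z≤n) le =
    ℕP.*-cancelʳ-≤ _ _ X {{X≢0}} (subst₂ _≤_ lhs rhs le)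
    where
      open ≡-Reasoning
      open +-*-Solver
      p = suc p′
      q = suc p
      r = suc r′
      X = q * p * qint q r
      X≢0 : NonZero X
      X≢0 = ℕ.>-nonZero (ℕP.*-mono-≤ {1} {q * p} (s≤s z≤n)
              (ℕP.≤-trans (ℕP.m^n>0 q r′) (ℕP.m≤m+n (q ^ r′) (qint q r′))))
      lhs : (q ^ suc e * qint q r) * (q ^ suc r ∸ 1) ≡ (q ^ e * qint q (suc r)) * X
      lhs = begin
        (q ^ suc e * qint q r) * (q ^ suc r ∸ 1)  ≡⟨ cong ((q ^ suc e * qint q r) *_) (pred-^ p (suc r)) ⟩
        (q * q ^ e * qint q r) * (p * qint q (suc r))
          ≡⟨ solve 5 (λ q p a b c → (q :* a :* b) :* (p :* c) := (a :* c) :* (q :* p :* b)) refl q p (q ^ e) (qint q r) (qint q (suc r)) ⟩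
        (q ^ e * qint q (suc r)) * X              ∎
      rhs : w * (q ^ suc r ∸ q) ≡ w * X
      rhs = cong (w *_) (begin
        q * q ^ r ∸ q        ≡⟨ cong (q * q ^ r ∸_) (ℕP.*-identityʳ q) ⟨
        q * q ^ r ∸ q * 1    ≡⟨ ℕP.*-distribˡ-∸ q (q ^ r) 1 ⟨
        q * (q ^ r ∸ 1)      ≡⟨ cong (q *_) (pred-^ p r) ⟩
        q * (p * qint q r)   ≡⟨ ℕP.*-assoc q p (qint q r) ⟨
        X                    ∎)

open Arithmetic

module Field (F : FiniteField) where
  open FiniteField F public

  ring : CommutativeRing 0ℓ 0ℓ
  ring = record { isCommutativeRing = isCommutativeRing }

  open CommutativeRing ring public
    using (+-identityʳ; *-assoc; *-comm; *-identityˡ; *-identityʳ; zeroˡ; zeroʳ; -‿inverseʳ)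
  open CommutativeRing ring using (commutativeSemiring; semiring; +-abelianGroup)
  open import Algebra.Properties.Ring (CommutativeRing.ring ring) public using (-‿distribˡ-*)
  open import Algebra.Properties.AbelianGroup +-abelianGroup using (x∙y⁻¹≈ε⇒x≈y)
  open import Algebra.Solver.Ring.NaturalCoefficients.Default commutativeSemiring public
  open import Algebra.Properties.Semiring.Sum semiring public
    using (sum; sum-cong-≗; sum-replicate-zero; ∑-distrib-+; *-distribˡ-sum; *-distribʳ-sum; sum-remove)

  1≢0 : 1# ≢ 0#
  1≢0 1≡0 = 0≢1 (sym 1≡0)

  inv : ∀ x → x ≢ 0# → Carrier
  inv x x≢0 = proj₁ (inverse x x≢0)

  inv-*ʳ : ∀ x (x≢0 : x ≢ 0#) → x * inv x x≢0 ≡ 1#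
  inv-*ʳ x x≢0 = proj₂ (inverse x x≢0)

  inv-*ˡ : ∀ x (x≢0 : x ≢ 0#) y → inv x x≢0 * (x * y) ≡ y
  inv-*ˡ x x≢0 y = begin
    inv x x≢0 * (x * y)  ≡⟨ *-assoc _ x y ⟨
    inv x x≢0 * x * y    ≡⟨ cong (_* y) (trans (*-comm _ x) (inv-*ʳ x x≢0)) ⟩
    1# * y               ≡⟨ *-identityˡ y ⟩
    y                    ∎
    where open ≡-Reasoning

  *-cancelˡ : ∀ x {y z} → x ≢ 0# → x * y ≡ x * z → y ≡ z
  *-cancelˡ x {y} {z} x≢0 xy≡xz =
    trans (sym (inv-*ˡ x x≢0 y)) (trans (cong (inv x x≢0 *_) xy≡xz) (inv-*ˡ x x≢0 z))

  zero-product : ∀ x {y} → x ≢ 0# → x * y ≡ 0# → y ≡ 0#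
  zero-product x x≢0 xy≡0 = *-cancelˡ x x≢0 (trans xy≡0 (sym (zeroʳ x)))

  *-≢0 : ∀ {x y} → x ≢ 0# → y ≢ 0# → x * y ≢ 0#
  *-≢0 {x} x≢0 y≢0 xy≡0 = y≢0 (zero-product x x≢0 xy≡0)

  ≢0-*ˡ : ∀ x y → x * y ≢ 0# → x ≢ 0#
  ≢0-*ˡ x y xy≢0 refl = xy≢0 (zeroˡ y)

  ≢0-*ʳ : ∀ x y → x * y ≢ 0# → y ≢ 0#
  ≢0-*ʳ x y xy≢0 refl = xy≢0 (zeroʳ x)

  ¬≢0⇒≡0 : ∀ x → ¬ (x ≢ 0#) → x ≡ 0#
  ¬≢0⇒≡0 x ¬x≢0 with x ≟ 0#
  ... | yes x≡0 = x≡0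
  ... | no  x≢0 = ⊥-elim (¬x≢0 x≢0)

  x-yz≡0⇒x≡yz : ∀ x y z → x + - y * z ≡ 0# → x ≡ y * z
  x-yz≡0⇒x≡yz x y z eq = x∙y⁻¹≈ε⇒x≈y x (y * z) (trans (cong (x +_) (-‿distribˡ-* y z)) eq)

  x≡yz⇒x-yz≡0 : ∀ x y z → x ≡ y * z → x + - y * z ≡ 0#
  x≡yz⇒x-yz≡0 x y z refl = trans (cong (y * z +_) (sym (-‿distribˡ-* y z))) (-‿inverseʳ (y * z))

  sumF≗sum : ∀ n (f : Fin n → Carrier) → sumF F n f ≡ sum f
  sumF≗sum zero    f = refl
  sumF≗sum (suc n) f = cong (f zero +_) (sumF≗sum n (λ i → f (suc i)))

  sumF-cong : ∀ n {f g : Fin n → Carrier} → (∀ i → f i ≡ g i) → sumF F n f ≡ sumF F n g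
  sumF-cong n {f} {g} f≗g =
    trans (sumF≗sum n f) (trans (sum-cong-≗ f≗g) (sym (sumF≗sum n g)))

  sumF-+ : ∀ n (f g : Fin n → Carrier) →
    sumF F n (λ i → f i + g i) ≡ sumF F n f + sumF F n g
  sumF-+ n f g
    rewrite sumF≗sum n f | sumF≗sum n g | sumF≗sum n (λ i → f i + g i) = ∑-distrib-+ f g

  sumF-*ˡ : ∀ n c (f : Fin n → Carrier) → sumF F n (λ i → c * f i) ≡ c * sumF F n f
  sumF-*ˡ n c f rewrite sumF≗sum n f | sumF≗sum n (λ i → c * f i) = sym (*-distribˡ-sum c f)

  sumF-*ʳ : ∀ n c (f : Fin n → Carrier) → sumF F n (λ i → f i * c) ≡ sumF F n f * c
  sumF-*ʳ n c f rewrite sumF≗sum n f | sumF≗sum n (λ i → f i * c) = sym (*-distribʳ-sum c f)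

  sumF-punchIn : ∀ n k (f : Fin (suc n) → Carrier) →
    sumF F (suc n) f ≡ f k + sumF F n (λ i → f (punchIn k i))
  sumF-punchIn n k f rewrite sumF≗sum n (λ i → f (punchIn k i)) | sumF≗sum n (λ i → f (suc i)) =
    sum-remove {i = k} f

  sumF-zero : ∀ n (f : Fin n → Carrier) → (∀ i → f i ≡ 0#) → sumF F n f ≡ 0#
  sumF-zero n f f≡0 = trans (sumF≗sum n f) (trans (sum-cong-≗ f≡0) (sum-replicate-zero n))

  sumF-single : ∀ n k (f : Fin n → Carrier) → (∀ i → i ≢ k → f i ≡ 0#) → sumF F n f ≡ f k
  sumF-single (suc n) k f others≡0 = begin
    sumF F (suc n) f                         ≡⟨ sumF-punchIn n k f ⟩
    f k + sumF F n (λ i → f (punchIn k i))   ≡⟨ cong (f k +_) (sumF-zero n _ (λ i → others≡0 _ (FinP.punchInᵢ≢i k i))) ⟩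
    f k + 0#                                 ≡⟨ +-identityʳ (f k) ⟩
    f k                                      ∎
    where open ≡-Reasoning

  δ : ∀ {n} → Fin n → Fin n → Carrier
  δ k i with k FinP.≟ i
  ... | yes _ = 1#
  ... | no  _ = 0#

  δ-diag : ∀ {n} (k : Fin n) → δ k k ≡ 1#
  δ-diag k with k FinP.≟ k
  ... | yes _   = refl
  ... | no  k≢k = ⊥-elim (k≢k refl)

  δ-off : ∀ {n} {k i : Fin n} → k ≢ i → δ k i ≡ 0#
  δ-off {k = k} {i} k≢i with k FinP.≟ i
  ... | yes k≡i = ⊥-elim (k≢i k≡i)
  ... | no  _   = refl

  sumF-δ : ∀ n (k : Fin n) (g : Fin n → Carrier) → sumF F n (λ i → δ k i * g i) ≡ g k
  sumF-δ n k g = trans (sumF-single n k _ (λ i i≢k → trans (cong (_* g i) (δ-off (i≢k ∘ sym))) (zeroˡ (g i))))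
                       (trans (cong (_* g k) (δ-diag k)) (*-identityˡ (g k)))

∣∣≡sum𝟙 : ∀ {n} (S : Subset n) {P : Fin n → Set} (P? : ∀ i → Dec (P i)) →
  (∀ i → (i ∈ₛ S) ⇔ P i) → ∣ S ∣ ≡ ℕΣ.sum (λ i → 𝟙[ P? i ])
∣∣≡sum𝟙 []          P? S⇔P = refl
∣∣≡sum𝟙 (b ∷ S) {P} P? S⇔P = head-case b (P? zero) (S⇔P zero)
  where
    tail⇔ : ∀ i → (i ∈ₛ S) ⇔ P (suc i)
    tail⇔ i = mk⇔ (Equivalence.to (S⇔P (suc i)) ∘ there) (drop-there ∘ Equivalence.from (S⇔P (suc i)))
    ∣S∣≡ = ∣∣≡sum𝟙 S (P? ∘ suc) tail⇔
    head-case : ∀ b′ → (P0? : Dec (P zero)) → (zero ∈ₛ b′ ∷ S) ⇔ P zero →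
      ∣ b′ ∷ S ∣ ≡ 𝟙[ P0? ] ℕ.+ ℕΣ.sum (λ i → 𝟙[ P? (suc i) ])
    head-case inside  (yes _)  _      = cong suc ∣S∣≡
    head-case outside (no  _)  _      = ∣S∣≡
    head-case inside  (no ¬p0) 0∈⇔P0 = ⊥-elim (¬p0 (Equivalence.to 0∈⇔P0 here))
    head-case outside (yes p0) 0∈⇔P0 with Equivalence.from 0∈⇔P0 p0
    ... | ()

subsetOf : ∀ {n} {P : Fin n → Set} → (∀ i → Dec (P i)) → Subset n
subsetOf {zero}  P? = []
subsetOf {suc n} P? = does (P? zero) ∷ subsetOf (P? ∘ suc)

∈subsetOf⇔ : ∀ {n} {P : Fin n → Set} (P? : ∀ i → Dec (P i)) i → (i ∈ₛ subsetOf P?) ⇔ P i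
∈subsetOf⇔ P? zero with P? zero
... | yes p  = mk⇔ (λ _ → p) (λ _ → here)
... | no  ¬p = mk⇔ (λ ()) (⊥-elim ∘ ¬p)
∈subsetOf⇔ P? (suc i) =
  mk⇔ (Equivalence.to (∈subsetOf⇔ (P? ∘ suc) i) ∘ drop-there)
      (there ∘ Equivalence.from (∈subsetOf⇔ (P? ∘ suc) i))

module Supports (F : FiniteField) where
  open Field F

  Nonzero : ∀ {k} → (Fin k → Carrier) → Set
  Nonzero v = ∃ λ i → v i ≢ 0#

  nonzero? : ∀ {k} (v : Fin k → Carrier) → Dec (Nonzero v)
  nonzero? v = FinP.any? (λ i → ¬? (v i ≟ 0#))

  -- Coordinate i lies in the support of the span of b iff the i-th column
  -- (b₀ i, …, b_{r-1} i) is nonzero.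
  InSupport : ∀ {r n} → (Fin r → Word F n) → Fin n → Set
  InSupport b i = Nonzero (λ k → b k i)

  support? : ∀ {r n} (b : Fin r → Word F n) i → Dec (InSupport b i)
  support? b i = nonzero? (λ k → b k i)

  weight : ∀ {r n} → (Fin r → Word F n) → ℕ
  weight b = ℕΣ.sum (λ i → 𝟙[ support? b i ])

  span-nonzero⇔InSupport : ∀ {r n} (b : Fin r → Word F n) i →
    (∃[ c ] (InSpan F b c × c i ≢ 0#)) ⇔ InSupport b i
  span-nonzero⇔InSupport {r} b i = mk⇔ to from
    where
      to : ∃[ c ] (InSpan F b c × c i ≢ 0#) → InSupport b i
      to (c , (a , c≡ab) , ci≢0) with support? b i
      ... | yes sup = sup
      ... | no ¬sup = ⊥-elim (ci≢0 (trans (c≡ab i) (sumF-zero r _ λ k →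
              trans (cong (a k *_) (¬≢0⇒≡0 (b k i) (λ bki≢0 → ¬sup (k , bki≢0)))) (zeroʳ (a k)))))
      from : InSupport b i → ∃[ c ] (InSpan F b c × c i ≢ 0#)
      from (k , bki≢0) = b k , (δ k , λ j → sym (sumF-δ r k (λ k′ → b k′ j))) , bki≢0

  weight-isSupportWeight : ∀ {r n} (b : Fin r → Word F n) → SupportWeight F b (weight b)
  weight-isSupportWeight b =
    S , ∣∣≡sum𝟙 S (support? b) S⇔ , λ i → mk⇔
      (Equivalence.from (span-nonzero⇔InSupport b i) ∘ Equivalence.to (S⇔ i))
      (Equivalence.from (S⇔ i) ∘ Equivalence.to (span-nonzero⇔InSupport b i))
    where
      S = subsetOf (support? b)
      S⇔ = ∈subsetOf⇔ (support? b)

  supportWeight≡weight : ∀ {r n} (b : Fin r → Word F n) w → SupportWeight F b w → w ≡ weight b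
  supportWeight≡weight b w (S , ∣S∣≡w , S⇔) =
    trans (sym ∣S∣≡w) (∣∣≡sum𝟙 S (support? b) λ i → mk⇔
      (Equivalence.to (span-nonzero⇔InSupport b i) ∘ Equivalence.to (S⇔ i))
      (Equivalence.from (S⇔ i) ∘ Equivalence.from (span-nonzero⇔InSupport b i)))

module Matrices (F : FiniteField) where
  open Field F

  eval-linear : ∀ {ℓ m} α β (f g M : Mat F ℓ m) →
    eval F (λ a b → α * f a b + β * g a b) M ≡ α * eval F f M + β * eval F g M
  eval-linear {ℓ} {m} α β f g M = begin
    sumF F ℓ (λ a → sumF F m (λ b → (α * f a b + β * g a b) * M a b))
      ≡⟨ sumF-cong ℓ (λ a → row a) ⟩
    sumF F ℓ (λ a → α * eval-row f a + β * eval-row g a)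
      ≡⟨ sumF-+ ℓ _ _ ⟩
    sumF F ℓ (λ a → α * eval-row f a) + sumF F ℓ (λ a → β * eval-row g a)
      ≡⟨ cong₂ _+_ (sumF-*ˡ ℓ α _) (sumF-*ˡ ℓ β _) ⟩
    α * eval F f M + β * eval F g M  ∎
    where
      open ≡-Reasoning
      eval-row : Mat F ℓ m → Fin ℓ → Carrier
      eval-row h a = sumF F m (λ b → h a b * M a b)
      row : ∀ a → sumF F m (λ b → (α * f a b + β * g a b) * M a b) ≡ α * eval-row f a + β * eval-row g a
      row a = trans (sumF-cong m (λ b → solve 5 (λ α β x y z → (α :* x :+ β :* y) :* z := α :* (x :* z) :+ β :* (y :* z)) refl α β (f a b) (g a b) (M a b)))
                (trans (sumF-+ m _ _) (cong₂ _+_ (sumF-*ˡ m α _) (sumF-*ˡ m β _)))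

  unitMat : ∀ {ℓ m} → Fin ℓ → Fin m → Mat F ℓ m
  unitMat a₀ b₀ a b = δ a₀ a * δ b₀ b

  eval-unitMat : ∀ {ℓ m} (a₀ : Fin ℓ) (b₀ : Fin m) (M : Mat F ℓ m) → eval F (unitMat a₀ b₀) M ≡ M a₀ b₀
  eval-unitMat {ℓ} {m} a₀ b₀ M = trans (sumF-cong ℓ row) (sumF-δ ℓ a₀ (λ a → M a b₀))
    where
      row : ∀ a → sumF F m (λ b → unitMat a₀ b₀ a b * M a b) ≡ δ a₀ a * M a b₀
      row a = trans (sumF-cong m (λ b → *-assoc (δ a₀ a) (δ b₀ b) (M a b)))
                (trans (sumF-*ˡ m (δ a₀ a) _) (cong (δ a₀ a *_) (sumF-δ m b₀ (M a))))

  unitMat-diag : ∀ {ℓ m} (a : Fin ℓ) (b : Fin m) → unitMat a b a b ≡ 1#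
  unitMat-diag a b = trans (cong₂ _*_ (δ-diag a) (δ-diag b)) (*-identityˡ 1#)

  unitMat-off : ∀ {ℓ m} {a x : Fin ℓ} {b y : Fin m} → (a , b) ≢ (x , y) → unitMat a b x y ≡ 0#
  unitMat-off {a = a} {x} {b} {y} ab≢xy = by-cases (a FinP.≟ x) (b FinP.≟ y)
    where
      by-cases : Dec (a ≡ x) → Dec (b ≡ y) → unitMat a b x y ≡ 0#
      by-cases (yes a≡x) (yes b≡y) = ⊥-elim (ab≢xy (cong₂ _,_ a≡x b≡y))
      by-cases (no  a≢x) _         = trans (cong (_* δ b y) (δ-off a≢x)) (zeroˡ (δ b y))
      by-cases (yes _)   (no  b≢y) = trans (cong (δ a x *_) (δ-off b≢y)) (zeroʳ (δ a x))

  rank-one-factors : ∀ {ℓ m} (M : Mat F ℓ m) → HasRank F 1 M →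
    ∃₂ λ (u : Vec Carrier ℓ) (v : Vec Carrier m) → ∀ x y → M x y ≡ lookup u x * lookup v y
  rank-one-factors M ((U , V , M≡UV) , _) =
    tabulate (λ x → U x zero) , tabulate (λ y → V zero y) , λ x y →
      trans (M≡UV x y) (trans (+-identityʳ _)
        (sym (cong₂ _*_ (VecP.lookup∘tabulate _ x) (VecP.lookup∘tabulate _ y))))

  unitMat-rank1 : ∀ {ℓ m} (a : Fin ℓ) (b : Fin m) → HasRank F 1 (unitMat a b)
  unitMat-rank1 a b =
    ((λ x _ → δ a x) , (λ _ y → δ b y) , λ x y → sym (+-identityʳ _)) ,
    λ (_ , _ , E≡0) → 1≢0 (trans (sym (unitMat-diag a b)) (E≡0 a b))

  proportional-reps : ∀ {ℓ m n} (reps : Fin n → Mat F ℓ m) → IsRank1Reps F reps →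
    ∀ {i j} (P : Mat F ℓ m) γ γ′ → γ′ ≢ 0# →
    (∀ x y → reps i x y ≡ γ * P x y) → (∀ x y → reps j x y ≡ γ′ * P x y) → i ≡ j
  proportional-reps reps isReps {i} {j} P γ γ′ γ′≢0 repi≡γP repj≡γ′P =
    proj₂ (proj₂ isReps) i j (γ * inv γ′ γ′≢0) λ x y → begin
      reps i x y                              ≡⟨ repi≡γP x y ⟩
      γ * P x y                               ≡⟨ cong (γ *_) (inv-*ˡ γ′ γ′≢0 (P x y)) ⟨
      γ * (inv γ′ γ′≢0 * (γ′ * P x y))        ≡⟨ *-assoc γ (inv γ′ γ′≢0) (γ′ * P x y) ⟨
      γ * inv γ′ γ′≢0 * (γ′ * P x y)          ≡⟨ cong (γ * inv γ′ γ′≢0 *_) (repj≡γ′P x y) ⟨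
      γ * inv γ′ γ′≢0 * reps j x y            ∎
    where open ≡-Reasoning

lookup-ext : ∀ {A : Set} {k} (xs ys : Vec A k) → (∀ i → lookup xs i ≡ lookup ys i) → xs ≡ ys
lookup-ext xs ys xs≗ys =
  trans (sym (VecP.tabulate∘lookup xs)) (trans (VecP.tabulate-cong xs≗ys) (VecP.tabulate∘lookup ys))

module Vectors (F : FiniteField) where
  open Field F
  open Supports F using (Nonzero; nonzero?)

  q : ℕ
  q = card

  allVec : ∀ k → List (Vec Carrier k)
  allVec zero    = [] ∷ []
  allVec (suc k) = cartesianProductWith _∷_ elements (allVec k)

  length-allVec : ∀ k → length (allVec k) ≡ q ^ k
  length-allVec zero    = refl
  length-allVec (suc k) =
    trans (length-cartesianProductWith _∷_ elements (allVec k)) (cong (q ℕ.*_) (length-allVec k))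

  allVec-complete : ∀ {k} (v : Vec Carrier k) → v ∈ allVec k
  allVec-complete []      = here refl
  allVec-complete (x ∷ v) = ∈-cartesianProductWith⁺ _∷_ (complete x) (allVec-complete v)

  allVec-unique : ∀ k → Unique (allVec k)
  allVec-unique zero    = [] ∷ []
  allVec-unique (suc k) = UniqueP.cartesianProductWith⁺ _∷_ VecP.∷-injective unique (allVec-unique k)

  count-zero : ∀ k → length (filter (λ v → ¬? (nonzero? (lookup v))) (allVec k)) ≡ 1
  count-zero k = unique-⊆⊇⇒length≡ (UniqueP.filter⁺ isZero? (allVec-unique k)) ([] ∷ []) sub sup
    where
      isZero? = λ (v : Vec Carrier k) → ¬? (nonzero? (lookup v))
      0v = Vec.replicate k 0#
      sub : ∀ {v} → v ∈ filter isZero? (allVec k) → v ∈ 0v ∷ []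
      sub {v} v∈ = here (lookup-ext v 0v λ i →
        trans (¬≢0⇒≡0 _ (λ vi≢0 → proj₂ (∈-filter⁻ isZero? {xs = allVec k} v∈) (i , vi≢0))) (sym (VecP.lookup-replicate i 0#)))
      sup : ∀ {v} → v ∈ 0v ∷ [] → v ∈ filter isZero? (allVec k)
      sup (here refl) = ∈-filter⁺ isZero? (allVec-complete 0v) λ (i , 0≢0) → 0≢0 (VecP.lookup-replicate i 0#)

  count-nonzero : ∀ k → length (filter (nonzero? ∘ lookup) (allVec k)) ≡ q ^ k ∸ 1
  count-nonzero k = begin
    N                                  ≡⟨ ℕP.m+n∸n≡m N 1 ⟨
    N ℕ.+ 1 ∸ 1                        ≡⟨ cong (λ z → N ℕ.+ z ∸ 1) (count-zero k) ⟨
    N ℕ.+ length (filter _ (allVec k)) ∸ 1  ≡⟨ cong (_∸ 1) (length-filter-∁ (nonzero? ∘ lookup) (allVec k)) ⟩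
    length (allVec k) ∸ 1              ≡⟨ cong (_∸ 1) (length-allVec k) ⟩
    q ^ k ∸ 1                          ∎
    where open ≡-Reasoning
          N = length (filter (nonzero? ∘ lookup) (allVec k))

  Parallel : ∀ {k} → Vec Carrier k → (Fin k → Carrier) → Set
  Parallel λv v = ∃ λ t → ∀ i → lookup λv i ≡ t * v i

  parallel? : ∀ {k} (λv : Vec Carrier k) v → Dec (Parallel λv v)
  parallel? λv v with Any.any? (λ t → FinP.all? (λ i → lookup λv i ≟ (t * v i))) elements
  ... | yes found = yes (Any.satisfied found)
  ... | no  none  = no λ (t , λ≡tv) → none (Any.map (λ { refl → λ≡tv }) (complete t))

  -- A nonzero vector of F^k has exactly q vectors parallel to it, namely its
  -- q scalar multiples, which are pairwise distinct.
  count-parallel : ∀ {k} (v : Fin k → Carrier) → Nonzero v →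
    length (filter (λ λv → parallel? λv v) (allVec k)) ≡ q
  count-parallel {k} v (j , vj≢0) =
    trans (unique-⊆⊇⇒length≡ (UniqueP.filter⁺ (λ λv → parallel? λv v) (allVec-unique k))
                             (UniqueP.map⁺ multiple-injective unique) sub sup)
          (ListP.length-map multiple elements)
    where
      multiple : Carrier → Vec Carrier k
      multiple t = tabulate (λ i → t * v i)
      multiple-injective : ∀ {t t′} → multiple t ≡ multiple t′ → t ≡ t′
      multiple-injective {t} {t′} eq = *-cancelˡ (v j) vj≢0 (begin
        v j * t          ≡⟨ *-comm (v j) t ⟩
        t * v j          ≡⟨ VecP.lookup∘tabulate _ j ⟨
        lookup (multiple t) j   ≡⟨ cong (λ w → lookup w j) eq ⟩
        lookup (multiple t′) j  ≡⟨ VecP.lookup∘tabulate _ j ⟩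
        t′ * v j         ≡⟨ *-comm t′ (v j) ⟩
        v j * t′         ∎)
        where open ≡-Reasoning
      sub : ∀ {λv} → λv ∈ filter (λ λv → parallel? λv v) (allVec k) → λv ∈ map multiple elements
      sub {λv} λv∈ with ∈-filter⁻ (λ λv → parallel? λv v) {xs = allVec k} λv∈
      ... | _ , (t , λ≡tv) = subst (_∈ map multiple elements)
              (lookup-ext _ _ (λ i → trans (VecP.lookup∘tabulate _ i) (sym (λ≡tv i))))
              (∈-map⁺ multiple (complete t))
      sup : ∀ {λv} → λv ∈ map multiple elements → λv ∈ filter (λ λv → parallel? λv v) (allVec k)
      sup λv∈ with ∈-map⁻ multiple λv∈
      ... | t , _ , refl = ∈-filter⁺ (λ λv → parallel? λv v) (allVec-complete _)
              (t , VecP.lookup∘tabulate _)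

  count-nonparallel : ∀ {k} (v : Fin k → Carrier) → Nonzero v →
    length (filter (λ λv → ¬? (parallel? λv v)) (allVec k)) ≡ q ^ k ∸ q
  count-nonparallel {k} v nz = begin
    K                                  ≡⟨ ℕP.m+n∸m≡n q K ⟨
    q ℕ.+ K ∸ q                        ≡⟨ cong (λ z → z ℕ.+ K ∸ q) (count-parallel v nz) ⟨
    length (filter _ (allVec k)) ℕ.+ K ∸ q  ≡⟨ cong (_∸ q) (length-filter-∁ (λ λv → parallel? λv v) (allVec k)) ⟩
    length (allVec k) ∸ q              ≡⟨ cong (_∸ q) (length-allVec k) ⟩
    q ^ k ∸ q                          ∎
    where open ≡-Reasoning
          K = length (filter (λ λv → ¬? (parallel? λv v)) (allVec k))

  -- Normalization scales a nonzero vector so that its first nonzero entry is 1;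
  -- it picks a canonical representative of each line through the origin.
  normalize : ∀ {k} → Vec Carrier k → Vec Carrier k
  normalize []      = []
  normalize (x ∷ v) with x ≟ 0#
  ... | yes _   = 0# ∷ normalize v
  ... | no  x≢0 = 1# ∷ Vec.map (inv x x≢0 *_) v

  normalize-nonzero-head : ∀ {k} x (v : Vec Carrier k) → x ≢ 0# → ∃ λ w → normalize (x ∷ v) ≡ 1# ∷ w
  normalize-nonzero-head x v x≢0 with x ≟ 0#
  ... | yes x≡0 = ⊥-elim (x≢0 x≡0)
  ... | no  x≢0′ = Vec.map (inv x x≢0′ *_) v , refl

  normalize-scale : ∀ {k} (v : Vec Carrier k) → Nonzero (lookup v) →
    ∃ λ c → c ≢ 0# × (∀ i → lookup v i ≡ c * lookup (normalize v) i)
  normalize-scale (x ∷ v) nz with x ≟ 0#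
  normalize-scale (x ∷ v) nz | no x≢0 = x , x≢0 , entries
    where
      entries : ∀ i → lookup (x ∷ v) i ≡ x * lookup (1# ∷ Vec.map (inv x x≢0 *_) v) i
      entries zero    = sym (*-identityʳ x)
      entries (suc i) = sym (begin
        x * lookup (Vec.map (inv x x≢0 *_) v) i  ≡⟨ cong (x *_) (VecP.lookup-map i _ v) ⟩
        x * (inv x x≢0 * lookup v i)             ≡⟨ *-assoc x _ _ ⟨
        x * inv x x≢0 * lookup v i               ≡⟨ cong (_* lookup v i) (inv-*ʳ x x≢0) ⟩
        1# * lookup v i                          ≡⟨ *-identityˡ _ ⟩
        lookup v i                               ∎)
        where open ≡-Reasoning
  normalize-scale (x ∷ v) (zero  , x≢0) | yes x≡0 = ⊥-elim (x≢0 x≡0)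
  normalize-scale (x ∷ v) (suc i , vi≢0) | yes x≡0 with normalize-scale v (i , vi≢0)
  ... | c , c≢0 , v≡c·nv = c , c≢0 , entries
    where
      entries : ∀ j → lookup (x ∷ v) j ≡ c * lookup (0# ∷ normalize v) j
      entries zero    = trans x≡0 (sym (zeroʳ c))
      entries (suc j) = v≡c·nv j

  -- The normalized nonzero vectors of F^k: [k]_q of them.
  Normalized : ∀ k → List (Vec Carrier k)
  Normalized zero    = []
  Normalized (suc k) = map (1# ∷_) (allVec k) ++ map (0# ∷_) (Normalized k)

  length-Normalized : ∀ k → length (Normalized k) ≡ qint q k
  length-Normalized zero    = refl
  length-Normalized (suc k) =
    trans (ListP.length-++ (map (1# ∷_) (allVec k)))
          (cong₂ ℕ._+_ (trans (ListP.length-map _ (allVec k)) (length-allVec k))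
                       (trans (ListP.length-map _ (Normalized k)) (length-Normalized k)))

  normalize∈Normalized : ∀ {k} (v : Vec Carrier k) → Nonzero (lookup v) → normalize v ∈ Normalized k
  normalize∈Normalized (x ∷ v) nz with x ≟ 0#
  normalize∈Normalized (x ∷ v) nz | no _ = ∈-++⁺ˡ (∈-map⁺ (1# ∷_) (allVec-complete _))
  normalize∈Normalized (x ∷ v) (zero  , x≢0) | yes x≡0 = ⊥-elim (x≢0 x≡0)
  normalize∈Normalized (x ∷ v) (suc i , vi≢0) | yes _ =
    ∈-++⁺ʳ (map (1# ∷_) (allVec _)) (∈-map⁺ (0# ∷_) (normalize∈Normalized v (i , vi≢0)))

  -- The normalized vectors of F^(s+t) whose leading 1 lies among the first
  -- s coordinates: [s]_q·q^t of them.
  Leading : ∀ s t → List (Vec Carrier (s ℕ.+ t))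
  Leading zero    t = []
  Leading (suc s) t = map (1# ∷_) (allVec (s ℕ.+ t)) ++ map (0# ∷_) (Leading s t)

  length-Leading : ∀ s t → length (Leading s t) ≡ qint q s ℕ.* q ^ t
  length-Leading zero    t = refl
  length-Leading (suc s) t = begin
    length (map (1# ∷_) (allVec (s ℕ.+ t)) ++ map (0# ∷_) (Leading s t))
      ≡⟨ ListP.length-++ (map (1# ∷_) (allVec (s ℕ.+ t))) ⟩
    length (map (1# ∷_) (allVec (s ℕ.+ t))) ℕ.+ length (map (0# ∷_) (Leading s t))
      ≡⟨ cong₂ ℕ._+_ (trans (ListP.length-map _ (allVec (s ℕ.+ t))) (length-allVec (s ℕ.+ t)))
                     (trans (ListP.length-map _ (Leading s t)) (length-Leading s t)) ⟩
    q ^ (s ℕ.+ t) ℕ.+ qint q s ℕ.* q ^ t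
      ≡⟨ cong (ℕ._+ qint q s ℕ.* q ^ t) (ℕP.^-distribˡ-+-* q s t) ⟩
    q ^ s ℕ.* q ^ t ℕ.+ qint q s ℕ.* q ^ t
      ≡⟨ ℕP.*-distribʳ-+ (q ^ t) (q ^ s) (qint q s) ⟨
    qint q (suc s) ℕ.* q ^ t  ∎
    where open ≡-Reasoning

  normalize∈Leading : ∀ s t (v : Vec Carrier (s ℕ.+ t)) (a : Fin s) → lookup v (a ↑ˡ t) ≢ 0# →
    normalize v ∈ Leading s t
  normalize∈Leading (suc s) t (x ∷ v) a va≢0 with x ≟ 0#
  normalize∈Leading (suc s) t (x ∷ v) a       va≢0 | no _   = ∈-++⁺ˡ (∈-map⁺ (1# ∷_) (allVec-complete _))
  normalize∈Leading (suc s) t (x ∷ v) zero    x≢0  | yes x≡0 = ⊥-elim (x≢0 x≡0)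
  normalize∈Leading (suc s) t (x ∷ v) (suc a) va≢0 | yes _ =
    ∈-++⁺ʳ (map (1# ∷_) (allVec _)) (∈-map⁺ (0# ∷_) (normalize∈Leading s t v a va≢0))

-- Kernel subcodes: the hyperplane sections of a subcode used in the averaging step.
module Kernels (F : FiniteField) where
  open Field F
  open Supports F
  open Matrices F using (eval-linear)
  open Vectors F

  -- Fix words b₀, …, b_r, a vector λ ∈ F^(r+1) and a pivot k₀ with λ_k₀ ≠ 0;
  -- σ : Fin r ↪ Fin (r+1) enumerates the indices other than k₀.  The r words
  --   κ_k = λ_k₀·b_(σ k) − λ_(σ k)·b_k₀
  -- span the kernel subcode {Σ_j a_j b_j : Σ_j a_j λ_j = 0} of span b.
  module Kernel {r n} (b : Fin (suc r) → Word F n) (λv : Vec Carrier (suc r))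
                (k₀ : Fin (suc r)) (λk₀≢0 : lookup λv k₀ ≢ 0#) where

    L : Fin (suc r) → Carrier
    L = lookup λv

    σ : Fin r → Fin (suc r)
    σ = punchIn k₀

    κ : Fin r → Word F n
    κ k i = L k₀ * b (σ k) i + - L (σ k) * b k₀ i

    κ-inCode : ∀ {ℓ m} (reps : Fin n → Mat F ℓ m) → (∀ j → InCdet F reps (b j)) →
      ∀ k → InCdet F reps (κ k)
    κ-inCode reps b∈C k with b∈C (σ k) | b∈C k₀
    ... | f , bσk≡f | f₀ , bk₀≡f₀ =
      (λ x y → L k₀ * f x y + - L (σ k) * f₀ x y) ,
      λ i → trans (cong₂ (λ u v → L k₀ * u + - L (σ k) * v) (bσk≡f i) (bk₀≡f₀ i))
                  (sym (eval-linear (L k₀) (- L (σ k)) f f₀ (reps i)))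

    -- A combination of the kernel words, rewritten as a combination of b.
    lift : (Fin r → Carrier) → Fin (suc r) → Carrier
    lift a j with k₀ FinP.≟ j
    ... | yes _    = sumF F r (λ k → a k * - L (σ k))
    ... | no k₀≢j = a (punchOut k₀≢j) * L k₀

    lift-k₀ : ∀ a → lift a k₀ ≡ sumF F r (λ k → a k * - L (σ k))
    lift-k₀ a with k₀ FinP.≟ k₀
    ... | yes _   = refl
    ... | no k₀≢k₀ = ⊥-elim (k₀≢k₀ refl)

    lift-σ : ∀ a k → lift a (σ k) ≡ a k * L k₀
    lift-σ a k with k₀ FinP.≟ σ k
    ... | yes k₀≡σk = ⊥-elim (FinP.punchInᵢ≢i k₀ k (sym k₀≡σk))
    ... | no  k₀≢σk = cong (λ j → a j * L k₀) (FinP.punchOut-punchIn k₀)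

    lincomb-lift : ∀ a i → lincomb F (lift a) b i ≡ lincomb F a κ i
    lincomb-lift a i = begin
      sumF F (suc r) (λ j → lift a j * b j i)
        ≡⟨ sumF-punchIn r k₀ (λ j → lift a j * b j i) ⟩
      lift a k₀ * b k₀ i + sumF F r (λ k → lift a (σ k) * b (σ k) i)
        ≡⟨ cong₂ _+_ (trans (cong (_* b k₀ i) (lift-k₀ a)) (sym (sumF-*ʳ r (b k₀ i) _)))
                     (sumF-cong r (λ k → cong (_* b (σ k) i) (lift-σ a k))) ⟩
      sumF F r (λ k → a k * - L (σ k) * b k₀ i) + sumF F r (λ k → a k * L k₀ * b (σ k) i)
        ≡⟨ sumF-+ r _ _ ⟨
      sumF F r (λ k → a k * - L (σ k) * b k₀ i + a k * L k₀ * b (σ k) i)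
        ≡⟨ sumF-cong r (λ k → solve 5 (λ a l′ x l y → a :* l′ :* x :+ a :* l :* y := a :* (l :* y :+ l′ :* x))
                                      refl (a k) (- L (σ k)) (b k₀ i) (L k₀) (b (σ k) i)) ⟩
      sumF F r (λ k → a k * κ k i)  ∎
      where open ≡-Reasoning

    κ-independent : LinIndep F b → LinIndep F κ
    κ-independent b-indep a aκ≡0 k =
      zero-product (L k₀) λk₀≢0 (begin
        L k₀ * a k    ≡⟨ *-comm (L k₀) (a k) ⟩
        a k * L k₀    ≡⟨ lift-σ a k ⟨
        lift a (σ k)  ≡⟨ b-indep (lift a) (λ i → trans (lincomb-lift a i) (aκ≡0 i)) (σ k) ⟩
        0#            ∎)
      where open ≡-Reasoning

    module _ (i : Fin n) where
      c : Fin (suc r) → Carrier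
      c j = b j i

      zero-column⇒κ≡0 : (∀ j → c j ≡ 0#) → ∀ k → κ k i ≡ 0#
      zero-column⇒κ≡0 c≡0 k rewrite c≡0 (σ k) | c≡0 k₀ =
        trans (cong₂ _+_ (zeroʳ (L k₀)) (zeroʳ (- L (σ k)))) (+-identityʳ 0#)

      parallel⇒κ≡0 : Parallel λv c → ∀ k → κ k i ≡ 0#
      parallel⇒κ≡0 (t , λ≡tc) k = x≡yz⇒x-yz≡0 (L k₀ * c (σ k)) (L (σ k)) (c k₀) (begin
        L k₀ * c (σ k)        ≡⟨ cong (_* c (σ k)) (λ≡tc k₀) ⟩
        t * c k₀ * c (σ k)    ≡⟨ solve 3 (λ t x y → t :* x :* y := t :* y :* x) refl t (c k₀) (c (σ k)) ⟩
        t * c (σ k) * c k₀    ≡⟨ cong (_* c k₀) (λ≡tc (σ k)) ⟨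
        L (σ k) * c k₀        ∎)
        where open ≡-Reasoning

      κ≡0⇒parallel : Nonzero c → (∀ k → κ k i ≡ 0#) → Parallel λv c
      κ≡0⇒parallel (j₀ , cj₀≢0) κ≡0 = inv μ μ≢0 , λ j → sym (begin
        inv μ μ≢0 * c j          ≡⟨ cong (inv μ μ≢0 *_) (c≡μL j) ⟩
        inv μ μ≢0 * (μ * L j)    ≡⟨ inv-*ˡ μ μ≢0 (L j) ⟩
        L j                      ∎)
        where
          open ≡-Reasoning
          ι = inv (L k₀) λk₀≢0
          μ = ι * c k₀
          -- every entry satisfies c_j = μ·λ_j, i.e. λ_k₀ c_j = λ_j c_k₀
          c≡μL : ∀ j → c j ≡ μ * L j
          c≡μL j with k₀ FinP.≟ j
          ... | yes refl = trans (sym (inv-*ˡ (L k₀) λk₀≢0 (c k₀)))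
                                 (solve 3 (λ ι l x → ι :* (l :* x) := ι :* x :* l) refl ι (L k₀) (c k₀))
          ... | no k₀≢j = subst (λ j′ → c j′ ≡ μ * L j′) (FinP.punchIn-punchOut k₀≢j) (begin
                  c (σ k)                  ≡⟨ inv-*ˡ (L k₀) λk₀≢0 (c (σ k)) ⟨
                  ι * (L k₀ * c (σ k))     ≡⟨ cong (ι *_) (x-yz≡0⇒x≡yz _ _ _ (κ≡0 k)) ⟩
                  ι * (L (σ k) * c k₀)     ≡⟨ solve 3 (λ ι l x → ι :* (l :* x) := ι :* x :* l) refl ι (L (σ k)) (c k₀) ⟩
                  μ * L (σ k)              ∎)
            where k = punchOut k₀≢j
          μ≢0 : μ ≢ 0#
          μ≢0 = ≢0-*ˡ μ (L j₀) (λ μL≡0 → cj₀≢0 (trans (c≡μL j₀) μL≡0))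

      κ-support⇔ : InSupport κ i ⇔ (Nonzero c × ¬ Parallel λv c)
      κ-support⇔ = mk⇔ to from
        where
          to : InSupport κ i → Nonzero c × ¬ Parallel λv c
          to (k , κki≢0) with nonzero? c
          ... | yes c≢0 = c≢0 , λ par → κki≢0 (parallel⇒κ≡0 par k)
          ... | no ¬c≢0 = ⊥-elim (κki≢0 (zero-column⇒κ≡0 (λ j → ¬≢0⇒≡0 (c j) (λ cj≢0 → ¬c≢0 (j , cj≢0))) k))
          from : Nonzero c × ¬ Parallel λv c → InSupport κ i
          from (c≢0 , ¬par) with support? κ i
          ... | yes sup = sup
          ... | no ¬sup = ⊥-elim (¬par (κ≡0⇒parallel c≢0 (λ k → ¬≢0⇒≡0 (κ k i) (λ κki≢0 → ¬sup (k , κki≢0)))))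

module LowerBound (F : FiniteField) where
  open Field F
  open Supports F
  open Vectors F
  open Kernels F

  q≥2 : 2 ≤ q
  q≥2 = unique-⊆⇒length≤ {xs = 0# ∷ 1# ∷ []} ((0≢1 ∷ []) ∷ [] ∷ []) (λ {x} _ → complete x)

  WeightBound : ∀ {ℓ m n} → (Fin n → Mat F ℓ m) → ℕ → ℕ → Set
  WeightBound {n = n} reps r w = ∀ (b : Fin r → Word F n) → IsSubcodeBasis F reps r b → w ≤ weight b

  -- Let b be a basis of an (r+1)-dimensional subcode D.
  -- Each nonzero λ ∈ F^(r+1) gives an r-dimensional kernel subcode D_λ ⊆ D, of
  -- weight ≥ w_r by assumption; coordinate i lies in supp D_λ iff i ∈ supp D and
  -- λ is not parallel to the i-th column of b, which happens for q^(r+1) − q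
  -- vectors λ.  Counting pairs (λ, i) gives
  --   (q^(r+1) − 1)·w_r ≤ Σ_λ ‖D_λ‖ = (q^(r+1) − q)·‖D‖.
  averaging-step : ∀ {ℓ m n} (reps : Fin n → Mat F ℓ m) r e → 1 ≤ r →
    WeightBound reps r (q ^ suc e ℕ.* qint q r) →
    WeightBound reps (suc r) (q ^ e ℕ.* qint q (suc r))
  averaging-step {n = n} reps r e r≥1 bound b (b∈C , b-indep) =
    averaging-bound q r e (weight b) q≥2 r≥1 (begin
      w ℕ.* (q ^ suc r ∸ 1)                              ≡⟨ count-nonzero-vectors ⟨
      sumOver V (λ λv → w ℕ.* 𝟙[ nonzero? (lookup λv) ])  ≤⟨ sumOver-mono V (λ λv → kernel-bound λv (nonzero? (lookup λv))) ⟩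
      sumOver V (λ λv → ℕΣ.sum (N λv))                    ≡⟨ double-count ⟩
      weight b ℕ.* (q ^ suc r ∸ q)                       ∎)
    where
      open ℕP.≤-Reasoning
      V = allVec (suc r)
      w = q ^ suc e ℕ.* qint q r

      column : Fin n → Fin (suc r) → Carrier
      column i j = b j i

      N : Vec Carrier (suc r) → Fin n → ℕ
      N λv i = 𝟙[ support? b i ×-dec ¬? (parallel? λv (column i)) ]

      kernel-bound : ∀ λv (nz? : Dec (Nonzero (lookup λv))) → w ℕ.* 𝟙[ nz? ] ≤ ℕΣ.sum (N λv)
      kernel-bound λv (no  _)              = ℕP.≤-trans (ℕP.≤-reflexive (ℕP.*-zeroʳ w)) z≤n
      kernel-bound λv (yes (k₀ , λk₀≢0)) = begin
        w ℕ.* 1           ≡⟨ ℕP.*-identityʳ w ⟩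
        w                 ≤⟨ bound κ (κ-inCode reps b∈C , κ-independent b-indep) ⟩
        weight κ          ≡⟨ ℕΣ.sum-cong-≗ (λ i → 𝟙-⇔ (κ-support⇔ i) (support? κ i) (support? b i ×-dec ¬? (parallel? λv (column i)))) ⟩
        ℕΣ.sum (N λv)     ∎
        where open Kernel b λv k₀ λk₀≢0

      count-nonzero-vectors : sumOver V (λ λv → w ℕ.* 𝟙[ nonzero? (lookup λv) ]) ≡ w ℕ.* (q ^ suc r ∸ 1)
      count-nonzero-vectors =
        trans (sumOver-*ˡ V w _) (cong (w ℕ.*_) (trans (sumOver-𝟙 (nonzero? ∘ lookup) V) (count-nonzero (suc r))))

      per-coordinate : ∀ i → sumOver V (λ λv → N λv i) ≡ 𝟙[ support? b i ] ℕ.* (q ^ suc r ∸ q)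
      per-coordinate i = begin-equality
        sumOver V (λ λv → N λv i)
          ≡⟨ sumOver-cong V (λ λv → 𝟙-× (support? b i) (¬? (parallel? λv (column i)))) ⟩
        sumOver V (λ λv → 𝟙[ support? b i ] ℕ.* 𝟙[ ¬? (parallel? λv (column i)) ])
          ≡⟨ sumOver-*ˡ V 𝟙[ support? b i ] (λ λv → 𝟙[ ¬? (parallel? λv (column i)) ]) ⟩
        𝟙[ support? b i ] ℕ.* sumOver V (λ λv → 𝟙[ ¬? (parallel? λv (column i)) ])
          ≡⟨ cong (𝟙[ support? b i ] ℕ.*_) (sumOver-𝟙 (λ λv → ¬? (parallel? λv (column i))) V) ⟩
        𝟙[ support? b i ] ℕ.* length (filter (λ λv → ¬? (parallel? λv (column i))) V)
          ≡⟨ count (support? b i) ⟩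
        𝟙[ support? b i ] ℕ.* (q ^ suc r ∸ q)  ∎
        where
          count : (sup? : Dec (InSupport b i)) →
            𝟙[ sup? ] ℕ.* length (filter (λ λv → ¬? (parallel? λv (column i))) V) ≡ 𝟙[ sup? ] ℕ.* (q ^ suc r ∸ q)
          count (yes sup) = cong (1 ℕ.*_) (count-nonparallel (column i) sup)
          count (no  _)   = refl

      double-count : sumOver V (λ λv → ℕΣ.sum (N λv)) ≡ weight b ℕ.* (q ^ suc r ∸ q)
      double-count = trans (sumOver-sum V N)
        (trans (ℕΣ.sum-cong-≗ per-coordinate) (sym (ℕΣ.*-distribʳ-sum (q ^ suc r ∸ q) (λ i → 𝟙[ support? b i ]))))

  averaging-iterate : ∀ {ℓ m n} (reps : Fin n → Mat F ℓ m) r₀ → 1 ≤ r₀ → ∀ s e →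
    WeightBound reps r₀ (q ^ (s ℕ.+ e) ℕ.* qint q r₀) →
    WeightBound reps (s ℕ.+ r₀) (q ^ e ℕ.* qint q (s ℕ.+ r₀))
  averaging-iterate reps r₀ r₀≥1 zero    e bound = bound
  averaging-iterate reps r₀ r₀≥1 (suc s) e bound =
    averaging-step reps (s ℕ.+ r₀) e (ℕP.≤-trans r₀≥1 (ℕP.m≤n+m r₀ s))
      (averaging-iterate reps r₀ r₀≥1 s (suc e)
        (subst (λ k → WeightBound reps r₀ (q ^ k ℕ.* qint q r₀)) (sym (ℕP.+-suc s e)) bound))

-- The upper bound comes from an explicit (m+s)-dimensional subcode: the span
-- of the coordinate forms X_(0,j) (j < m) and X_(a+1,0) (a < s), for
-- ℓ = 1 + s + t and m = 1 + m′.
module UpperBound (F : FiniteField) (s t m′ : ℕ) {n : ℕ}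
    (reps : Fin n → Mat F (suc (s ℕ.+ t)) (suc m′)) (isReps : IsRank1Reps F reps) where
  open Field F
  open Supports F
  open Matrices F
  open Vectors F

  ℓ m : ℕ
  ℓ = suc (s ℕ.+ t)
  m = suc m′

  slot : Fin m ⊎ Fin s → Fin ℓ × Fin m
  slot (inj₁ j) = zero , j
  slot (inj₂ a) = suc (a ↑ˡ t) , zero

  slot-injective : ∀ x y → slot x ≡ slot y → x ≡ y
  slot-injective (inj₁ j) (inj₁ j′) refl = refl
  slot-injective (inj₂ a) (inj₂ a′) eq =
    cong inj₂ (FinP.↑ˡ-injective t a a′ (FinP.suc-injective (cong proj₁ eq)))

  position : Fin (m ℕ.+ s) → Fin ℓ × Fin m
  position k = slot (splitAt m k)

  position-injective : ∀ k k′ → position k ≡ position k′ → k ≡ k′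
  position-injective k k′ eq = begin
    k                      ≡⟨ FinP.join-splitAt m s k ⟨
    join m s (splitAt m k)  ≡⟨ cong (join m s) (slot-injective _ _ eq) ⟩
    join m s (splitAt m k′) ≡⟨ FinP.join-splitAt m s k′ ⟩
    k′                     ∎
    where open ≡-Reasoning

  unit : Fin (m ℕ.+ s) → Mat F ℓ m
  unit k = unitMat (proj₁ (position k)) (proj₂ (position k))

  coordWords : Fin (m ℕ.+ s) → Word F n
  coordWords k i = eval F (unit k) (reps i)

  coordWords-entry : ∀ k i → coordWords k i ≡ reps i (proj₁ (position k)) (proj₂ (position k))
  coordWords-entry k i = eval-unitMat (proj₁ (position k)) (proj₂ (position k)) (reps i)

  -- Independence: the representative proportional to the unit matrix of
  -- position k′ sees only the k′-th coordinate form.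
  coordWords-independent : LinIndep F coordWords
  coordWords-independent a a·w≡0 k′
    with proj₁ (proj₂ isReps) (unit k′) (unitMat-rank1 (proj₁ (position k′)) (proj₂ (position k′)))
  ... | i , c , _ , unit≡c·rep = begin
    a k′                                            ≡⟨ *-identityʳ (a k′) ⟨
    a k′ * 1#                                       ≡⟨ cong (a k′ *_) (unitMat-diag (proj₁ (position k′)) (proj₂ (position k′))) ⟨
    a k′ * unit k′ (proj₁ (position k′)) (proj₂ (position k′))
      ≡⟨ sumF-single (m ℕ.+ s) k′ (λ k → a k * unit k′ (proj₁ (position k)) (proj₂ (position k)))
           (λ k k≢k′ → trans (cong (a k *_) (unitMat-off (k≢k′ ∘ position-injective k k′ ∘ sym))) (zeroʳ (a k))) ⟨
    sumF F (m ℕ.+ s) (λ k → a k * unit k′ (proj₁ (position k)) (proj₂ (position k)))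
      ≡⟨ sumF-cong (m ℕ.+ s) (λ k → cong (a k *_) (trans (unit≡c·rep _ _) (cong (c *_) (sym (coordWords-entry k i))))) ⟩
    sumF F (m ℕ.+ s) (λ k → a k * (c * coordWords k i))
      ≡⟨ sumF-cong (m ℕ.+ s) (λ k → solve 3 (λ a c w → a :* (c :* w) := c :* (a :* w)) refl (a k) c (coordWords k i)) ⟩
    sumF F (m ℕ.+ s) (λ k → c * (a k * coordWords k i))
      ≡⟨ sumF-*ˡ (m ℕ.+ s) c (λ k → a k * coordWords k i) ⟩
    c * lincomb F a coordWords i                    ≡⟨ cong (c *_) (a·w≡0 i) ⟩
    c * 0#                                          ≡⟨ zeroʳ c ⟩
    0#                                              ∎
    where open ≡-Reasoning

  coordWords-subcode : IsSubcodeBasis F reps (m ℕ.+ s) coordWords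
  coordWords-subcode = (λ k → unit k , λ i → refl) , coordWords-independent

  u : Fin n → Vec Carrier ℓ
  u i = proj₁ (rank-one-factors (reps i) (proj₁ isReps i))

  v : Fin n → Vec Carrier m
  v i = proj₁ (proj₂ (rank-one-factors (reps i) (proj₁ isReps i)))

  reps≡uv : ∀ i x y → reps i x y ≡ lookup (u i) x * lookup (v i) y
  reps≡uv i = proj₂ (proj₂ (rank-one-factors (reps i) (proj₁ isReps i)))

  support-entry : ∀ {i} → InSupport coordWords i →
    ∃ λ k → lookup (u i) (proj₁ (position k)) * lookup (v i) (proj₂ (position k)) ≢ 0#
  support-entry {i} (k , wki≢0) =
    k , λ uv≡0 → wki≢0 (trans (coordWords-entry k i) (trans (reps≡uv i _ _) uv≡0))

  -- The normalized factors determine the line of a representative, hence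
  -- (representatives being unique up to scalars) the representative itself.
  normalizedPair : Fin n → Vec Carrier ℓ × Vec Carrier m
  normalizedPair i = normalize (u i) , normalize (v i)

  rep-scaled : ∀ {i} → InSupport coordWords i → ∃ λ γ → γ ≢ 0# ×
    (∀ x y → reps i x y ≡ γ * (lookup (normalize (u i)) x * lookup (normalize (v i)) y))
  rep-scaled {i} sup with support-entry sup
  ... | k , uv≢0
    with normalize-scale (u i) (proj₁ (position k) , ≢0-*ˡ (lookup (u i) (proj₁ (position k))) (lookup (v i) (proj₂ (position k))) uv≢0)
       | normalize-scale (v i) (proj₂ (position k) , ≢0-*ʳ (lookup (u i) (proj₁ (position k))) (lookup (v i) (proj₂ (position k))) uv≢0)
  ... | α , α≢0 , u≡αu′ | β , β≢0 , v≡βv′ = α * β , *-≢0 α≢0 β≢0 , λ x y →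
    trans (reps≡uv i x y) (trans (cong₂ _*_ (u≡αu′ x) (v≡βv′ y))
      (solve 4 (λ a b c d → (a :* c) :* (b :* d) := (a :* b) :* (c :* d)) refl
         α β (lookup (normalize (u i)) x) (lookup (normalize (v i)) y)))

  normalizedPair-injective : ∀ {i j} → InSupport coordWords i → InSupport coordWords j →
    normalizedPair i ≡ normalizedPair j → i ≡ j
  normalizedPair-injective {i} {j} supi supj eq =
    proportional-reps reps isReps (outer i) (proj₁ scaledᵢ) (proj₁ scaledⱼ) (proj₁ (proj₂ scaledⱼ))
      (proj₂ (proj₂ scaledᵢ))
      (λ x y → trans (proj₂ (proj₂ scaledⱼ) x y)
                     (cong (λ p → proj₁ scaledⱼ * (lookup (proj₁ p) x * lookup (proj₂ p) y)) (sym eq)))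
    where
      scaledᵢ = rep-scaled supi
      scaledⱼ = rep-scaled supj
      outer : Fin n → Mat F ℓ m
      outer k x y = lookup (normalize (u k)) x * lookup (normalize (v k)) y

  -- Normalized factor pairs of supported representatives: either the first
  -- entry of u is nonzero (u ~ (1, ∗), v ~ any line), or it is zero and
  -- some u_(a+1) v_0 ≠ 0 with a < s (u ~ (0, leading in the first s), v ~ (1, ∗)).
  candidates : List (Vec Carrier ℓ × Vec Carrier m)
  candidates =
    cartesianProduct (map (1# ∷_) (allVec (s ℕ.+ t))) (Normalized m) ++
    cartesianProduct (map (0# ∷_) (Leading s t)) (map (1# ∷_) (allVec m′))

  length-candidates : length candidates ≡ q ^ (s ℕ.+ t) ℕ.* qint q m ℕ.+ qint q s ℕ.* q ^ t ℕ.* q ^ m′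
  length-candidates = begin
    length candidates
      ≡⟨ ListP.length-++ (cartesianProduct (map (1# ∷_) (allVec (s ℕ.+ t))) (Normalized m)) ⟩
    length (cartesianProduct (map (1# ∷_) (allVec (s ℕ.+ t))) (Normalized m))
      ℕ.+ length (cartesianProduct (map (0# ∷_) (Leading s t)) (map (1# ∷_) (allVec m′)))
      ≡⟨ cong₂ ℕ._+_
           (trans (length-cartesianProductWith _,_ (map (1# ∷_) (allVec (s ℕ.+ t))) (Normalized m))
                  (cong₂ ℕ._*_ (trans (ListP.length-map (1# ∷_) (allVec (s ℕ.+ t))) (length-allVec (s ℕ.+ t)))
                               (length-Normalized m)))
           (trans (length-cartesianProductWith _,_ (map (0# ∷_) (Leading s t)) (map (1# ∷_) (allVec m′)))
                  (cong₂ ℕ._*_ (trans (ListP.length-map (0# ∷_) (Leading s t)) (length-Leading s t))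
                               (trans (ListP.length-map (1# ∷_) (allVec m′)) (length-allVec m′)))) ⟩
    q ^ (s ℕ.+ t) ℕ.* qint q m ℕ.+ qint q s ℕ.* q ^ t ℕ.* q ^ m′  ∎
    where open ≡-Reasoning

  pair∈candidates : ∀ (u : Vec Carrier ℓ) (v : Vec Carrier m) x →
    lookup u (proj₁ (slot x)) * lookup v (proj₂ (slot x)) ≢ 0# → (normalize u , normalize v) ∈ candidates
  pair∈candidates (u₀ ∷ u′) v x uv≢0 with u₀ ≟ 0#
  pair∈candidates (u₀ ∷ u′) v x uv≢0 | no u₀≢0 =
        (∈-++⁺ˡ (∈-cartesianProduct⁺ (∈-map⁺ (1# ∷_) (allVec-complete (Vec.map (inv u₀ u₀≢0 *_) u′)))
          (normalize∈Normalized v (proj₂ (slot x) , ≢0-*ʳ (lookup (u₀ ∷ u′) (proj₁ (slot x))) (lookup v (proj₂ (slot x))) uv≢0))))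
  pair∈candidates (u₀ ∷ u′) v (inj₁ j) uv≢0 | yes u₀≡0 = ⊥-elim (uv≢0 (trans (cong (_* lookup v j) u₀≡0) (zeroˡ (lookup v j))))
  pair∈candidates (u₀ ∷ u′) (v₀ ∷ v′) (inj₂ a) uv≢0 | yes u₀≡0
    with normalize-nonzero-head v₀ v′ (≢0-*ʳ (lookup u′ (a ↑ˡ t)) v₀ uv≢0)
  ... | w , nv≡1w = subst (λ nv → (0# ∷ normalize u′ , nv) ∈ candidates) (sym nv≡1w)
        (∈-++⁺ʳ (cartesianProduct (map (1# ∷_) (allVec (s ℕ.+ t))) (Normalized m))
          (∈-cartesianProduct⁺ (∈-map⁺ (0# ∷_) (normalize∈Leading s t u′ a (≢0-*ˡ (lookup u′ (a ↑ˡ t)) v₀ uv≢0)))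
                               (∈-map⁺ (1# ∷_) (allVec-complete w))))

  -- The support of the coordinate subcode injects into the candidates.
  coordWords-weight : weight coordWords ≤ q ^ (s ℕ.+ t) ℕ.* qint q m ℕ.+ qint q s ℕ.* q ^ t ℕ.* q ^ m′
  coordWords-weight = begin
    weight coordWords                 ≡⟨ sumOver-tabulate (λ i → i) (λ i → 𝟙[ support? coordWords i ]) ⟨
    sumOver (allFin n) (λ i → 𝟙[ support? coordWords i ])  ≡⟨ sumOver-𝟙 (support? coordWords) (allFin n) ⟩
    length supp                       ≡⟨ ListP.length-map normalizedPair supp ⟨
    length (map normalizedPair supp)  ≤⟨ unique-⊆⇒length≤ (map-unique normalizedPair supp-unique injective) ⊆candidates ⟩
    length candidates                 ≡⟨ length-candidates ⟩
    q ^ (s ℕ.+ t) ℕ.* qint q m ℕ.+ qint q s ℕ.* q ^ t ℕ.* q ^ m′  ∎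
    where
      open ℕP.≤-Reasoning
      supp : List (Fin n)
      supp = filter (support? coordWords) (allFin n)
      supp-unique : Unique supp
      supp-unique = UniqueP.filter⁺ (support? coordWords) (UniqueP.allFin⁺ n)
      in-support : ∀ {i} → i ∈ supp → InSupport coordWords i
      in-support = proj₂ ∘ ∈-filter⁻ (support? coordWords) {xs = allFin n}
      injective : ∀ {i j} → i ∈ supp → j ∈ supp → normalizedPair i ≡ normalizedPair j → i ≡ j
      injective i∈ j∈ = normalizedPair-injective (in-support i∈) (in-support j∈)
      ⊆candidates : ∀ {p} → p ∈ map normalizedPair supp → p ∈ candidates
      ⊆candidates p∈ with ∈-map⁻ normalizedPair p∈
      ... | i , i∈ , refl = pair∈candidates (u i) (v i) (splitAt m (proj₁ entry)) (proj₂ entry)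
        where entry = support-entry (in-support i∈)

open import Data.Nat using (_+_; _*_)
open import Data.Nat.Solver using (module +-*-Solver)

-- The theorem for ℓ = 1 + s + t and m = 1 + m′, where the exponents
-- ℓ − s − 1 and ℓ + m − s − 2 of the statement become t and t + m′.
module Bounds (F : FiniteField) where
  open Supports F
  open Vectors F using (q)
  open LowerBound F

  bounds : ∀ s t m′ {n} (reps : Fin n → Mat F (suc (s + t)) (suc m′)) → IsRank1Reps F reps →
    ∀ dm → IsGHW F reps (suc m′) dm → dm ≡ q ^ (s + t) * qint q (suc m′) →
    ∀ d → IsGHW F reps (suc m′ + s) d →
      (q ^ t * qint q (suc m′ + s) ≡ dm + q ^ t * qint q s)
      × (dm + q ^ t * qint q s ≤ d)
      × (d ≤ dm + q ^ (t + m′) * qint q s)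
  bounds s t m′ reps isReps dm (_ , dm-minimal) dm≡ d ((b , b-subcode , b-weight) , d-minimal) =
    value , lower , upper
    where
      m = suc m′

      value : q ^ t * qint q (m + s) ≡ dm + q ^ t * qint q s
      value = begin
        q ^ t * qint q (m + s)                    ≡⟨ cong (q ^ t *_) (qint-+ q m s) ⟩
        q ^ t * (qint q s + q ^ s * qint q m)     ≡⟨ solve 4 (λ a b c d → a :* (c :+ b :* d) := b :* a :* d :+ a :* c) refl (q ^ t) (q ^ s) (qint q s) (qint q m) ⟩
        q ^ s * q ^ t * qint q m + q ^ t * qint q s ≡⟨ cong (λ z → z * qint q m + q ^ t * qint q s) (ℕP.^-distribˡ-+-* q s t) ⟨
        q ^ (s + t) * qint q m + q ^ t * qint q s   ≡⟨ cong (_+ q ^ t * qint q s) dm≡ ⟨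
        dm + q ^ t * qint q s                       ∎
        where open ≡-Reasoning
              open +-*-Solver

      -- d_m ≥ q^(s+t)·[m] is given; s averaging steps lift it to dimension m + s.
      lower : dm + q ^ t * qint q s ≤ d
      lower = subst₂ _≤_ value (sym (supportWeight≡weight b d b-weight))
        (subst (λ r → WeightBound reps r (q ^ t * qint q r)) (ℕP.+-comm s m)
          (averaging-iterate reps m (s≤s z≤n) s t
            (λ b′ b′-subcode → subst (_≤ weight b′) dm≡
               (dm-minimal b′ (weight b′) b′-subcode (weight-isSupportWeight b′))))
          b b-subcode)

      upper : d ≤ dm + q ^ (t + m′) * qint q s
      upper = begin
        d                  ≤⟨ d-minimal coordWords (weight coordWords) coordWords-subcode (weight-isSupportWeight coordWords) ⟩
        weight coordWords  ≤⟨ coordWords-weight ⟩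
        q ^ (s + t) * qint q m + qint q s * q ^ t * q ^ m′
          ≡⟨ cong₂ _+_ (sym dm≡) (trans (ℕP.*-assoc (qint q s) (q ^ t) (q ^ m′))
               (trans (cong (qint q s *_) (sym (ℕP.^-distribˡ-+-* q t m′))) (ℕP.*-comm (qint q s) (q ^ (t + m′))))) ⟩
        dm + q ^ (t + m′) * qint q s  ∎
        where open UpperBound F s t m′ reps isReps using (coordWords; coordWords-subcode; coordWords-weight)
              open ℕP.≤-Reasoning

exponent-lower : ∀ s t → suc (s + t) ∸ s ∸ 1 ≡ t
exponent-lower zero    t = refl
exponent-lower (suc s) t = exponent-lower s t

exponent-upper : ∀ s t m′ → suc (s + t) + suc m′ ∸ s ∸ 2 ≡ t + m′
exponent-upper zero    t m′ = cong (_∸ 1) (ℕP.+-suc t m′)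
exponent-upper (suc s) t m′ = exponent-upper s t m′

decompose : ∀ ℓ m s → 2 ≤ ℓ → ℓ ≤ m → s ≤ ℓ ∸ 1 → ∃₂ λ t m′ → ℓ ≡ suc (s + t) × m ≡ suc m′
decompose (suc ℓ′) (suc m′) s (s≤s _) (s≤s _) s≤ℓ′ = ℓ′ ∸ s , m′ , cong suc (sym (ℕP.m+[n∸m]≡n s≤ℓ′)) , refl

-- Lemma 4.5.
lemma4p5 : (F : FiniteField) → (ℓ m : ℕ) → 2 ≤ ℓ → ℓ ≤ m →
    (n : ℕ) → (reps : Fin n → Mat F ℓ m) → IsRank1Reps F {ℓ} {m} {n} reps →
    (dm : ℕ) → IsGHW F {ℓ} {m} {n} reps m dm →
    dm ≡ FiniteField.card F ^ (ℓ ∸ 1) * qint (FiniteField.card F) m →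
    (s : ℕ) → 1 ≤ s → s ≤ ℓ ∸ 1 →
    (d : ℕ) → IsGHW F {ℓ} {m} {n} reps (m + s) d →
    let q = FiniteField.card F in
    (q ^ (ℓ ∸ s ∸ 1) * qint q (m + s) ≡ dm + q ^ (ℓ ∸ s ∸ 1) * qint q s)
    × (dm + q ^ (ℓ ∸ s ∸ 1) * qint q s ≤ d)
    × (d ≤ dm + q ^ (ℓ + m ∸ s ∸ 2) * qint q s)
lemma4p5 F ℓ m 2≤ℓ ℓ≤m n reps isReps dm dm-ghw dm≡ s _ s≤ℓ-1 d d-ghw
  with decompose ℓ m s 2≤ℓ ℓ≤m s≤ℓ-1
... | t , m′ , refl , refl rewrite exponent-lower s t | exponent-upper s t m′ =
  Bounds.bounds F s t m′ reps isReps dm dm-ghw dm≡ d d-ghw
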